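{- Let $f\colon\{0,1\}^*\to\{0,1\}^*$ be a morphism such that $f(01)\neq f(10)$. Then $f\in\mathcal{M}_{\mathbf{x}}$ for every $\mathbf{x}\in\{0,1\}^{\mathbb{N}}$.
   Context: $\mathcal{S}_{\mathbf{x}}$ is the set of infinite binary words all of whose finite factors are factors of $\mathbf{x}$. $f\in\mathcal{M}_{\mathbf{x}}$ means: for each $c\in\{0,1\}$ there is a nonempty word $p_c$ such that every $\mathbf{y}\in\mathcal{S}_{\mathbf{x}}$ beginning with $c$ has $f(\mathbf{y})$ beginning with $p_c$, and neither of $p_0,p_1$ is a prefix of the other. -}

module Defs where

open import Data.Bool using (Bool; true; false)
open import Data.Nat using (ℕ; zero; suc; _+_)
open import Data.List using (List; []; _∷_; _++_; concatMap; length)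
open import Data.Product using (Σ; ∃; _×_; _,_)
open import Relation.Binary.PropositionalEquality using (_≡_)
open import Relation.Nullary using (¬_)

-- Binary alphabet {0,1} represented by Bool (0 = false, 1 = true).
-- Infinite binary words: functions ℕ → Bool.
InfWord : Set
InfWord = ℕ → Bool

-- A morphism of {0,1}^* is determined by the images of the letters.
Morphism : Set
Morphism = Bool → List Bool

apply : Morphism → List Bool → List Bool
apply f w = concatMap f w

IsPrefix : List Bool → List Bool → Set
IsPrefix p w = Σ (List Bool) λ s → p ++ s ≡ w

slice : InfWord → ℕ → ℕ → List Bool
slice y i zero = []
slice y i (suc n) = y i ∷ slice y (suc i) n

IsFactor : List Bool → InfWord → Set
IsFactor w y = Σ ℕ λ i → slice y i (length w) ≡ w

InS : InfWord → InfWord → Set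
InS x y = (w : List Bool) → IsFactor w y → IsFactor w x

-- f(y) begins with p: some image of a finite prefix of y has p as a prefix
-- (f(y) is the limit of f applied to the prefixes of y).
ImageBeginsWith : Morphism → InfWord → List Bool → Set
ImageBeginsWith f y p = Σ ℕ λ n → IsPrefix p (apply f (slice y 0 n))

NonEmpty : List Bool → Set
NonEmpty w = ¬ (w ≡ [])

InM : InfWord → Morphism → Set
InM x f =
  Σ (List Bool) λ p₀ → Σ (List Bool) λ p₁ →
    NonEmpty p₀ × NonEmpty p₁ ×
    ((y : InfWord) → InS x y → y 0 ≡ false → ImageBeginsWith f y p₀) ×
    ((y : InfWord) → InS x y → y 0 ≡ true → ImageBeginsWith f y p₁) ×
    ¬ IsPrefix p₀ p₁ × ¬ IsPrefix p₁ p₀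

module Submission where

-- Write u = f(0) and v = f(1).  Whether f ∈ M_x holds does not
-- depend on x at all: we show that if uv ≠ vu, there are nonempty, mutually
-- non-prefix words p₀, p₁ and a bound K such that f(c w) begins with p_c for
-- every letter c and every finite word w of length at least K (a
-- "separation" of f).  Since f(y) is read off the images of long prefixes of
-- y, this gives f ∈ M_x for every x, with S_x playing no role.
--
-- Separations are built by a Euclid-like descent on |u| + |v|.  If u and v
-- are incomparable for the prefix order, (p₀, p₁) = (u, v) works with K = 0.
-- If v = u v', then f = g ∘ τ for g = (0 ↦ u, 1 ↦ v') and τ = (0 ↦ 0,
-- 1 ↦ 01); g is again non-commuting and strictly smaller, and a separation
-- (p₀, p₁) of g yields the separation (u p₀, u p₁) of f.  The case u = v u'
-- is reduced to the previous one by exchanging the letters 0 and 1.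

open import Defs
open import Data.Bool using (Bool; true; false; not)
open import Data.Bool.Properties using (not-involutive) renaming (_≟_ to _≟ᴮ_)
open import Data.List using (List; []; _∷_; _++_; length; map)
open import Data.List.Properties
  using (++-assoc; ++-cancelˡ; ++-identityʳ; length-++-≤ʳ; length-map;
         concatMap-++; concatMap-cong; concatMap-map)
open import Data.Nat using (ℕ; zero; suc; _+_; _≤_; _<_; s≤s; z≤n)
open import Data.Nat.Properties
  using (≤-trans; ≤-reflexive; n≤1+n; <-≤-trans; +-monoʳ-<; +-comm)
open import Data.Nat.Induction using (<-wellFounded)
open import Data.Empty using (⊥-elim)
open import Data.Product using (_,_)
open import Function using (_∘_)
open import Induction.WellFounded using (Acc; acc)
open import Relation.Binary.PropositionalEquality
  using (_≡_; refl; sym; trans; cong; subst; module ≡-Reasoning)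
open import Relation.Nullary using (¬_; yes; no)

morphism : List Bool → List Bool → Morphism
morphism u v false = u
morphism u v true  = v

apply-∘ : (f g : Morphism) (w : List Bool) →
          apply f (apply g w) ≡ apply (apply f ∘ g) w
apply-∘ f g []      = refl
apply-∘ f g (c ∷ w) =
  trans (concatMap-++ f (g c) (apply g w)) (cong (apply f (g c) ++_) (apply-∘ f g w))

length-apply : (f : Morphism) → (∀ c → NonEmpty (f c)) →
               (w : List Bool) → length w ≤ length (apply f w)
length-apply f nonErasing []      = z≤n
length-apply f nonErasing (c ∷ w) with f c | nonErasing c
... | []    | ne = ⊥-elim (ne refl)
... | a ∷ s | _  = s≤s (≤-trans (length-apply f nonErasing w) (length-++-≤ʳ _ {s}))

length-slice : (y : InfWord) (i n : ℕ) → length (slice y i n) ≡ n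
length-slice y i zero    = refl
length-slice y i (suc n) = cong suc (length-slice y (suc i) n)

prefix-++ˡ : (u : List Bool) {p w : List Bool} → IsPrefix p w → IsPrefix (u ++ p) (u ++ w)
prefix-++ˡ u {p} (s , p++s≡w) = s , trans (++-assoc u p s) (cong (u ++_) p++s≡w)

prefix-cancelˡ : (u : List Bool) {p w : List Bool} → IsPrefix (u ++ p) (u ++ w) → IsPrefix p w
prefix-cancelˡ u {p} {w} (s , eq) = s , ++-cancelˡ u (p ++ s) w (trans (sym (++-assoc u p s)) eq)

nonEmpty-++ : (u : List Bool) {p : List Bool} → NonEmpty p → NonEmpty (u ++ p)
nonEmpty-++ []      ne = ne
nonEmpty-++ (_ ∷ _) _  = λ ()

data Comparison (u v : List Bool) : Set where
  extends  : (v' : List Bool) → u ++ v' ≡ v → Comparison u v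
  extended : (u' : List Bool) → v ++ u' ≡ u → Comparison u v
  neither  : ¬ IsPrefix u v → ¬ IsPrefix v u → Comparison u v

compare : (u v : List Bool) → Comparison u v
compare []      v       = extends v refl
compare (a ∷ u) []      = extended (a ∷ u) refl
compare (a ∷ u) (b ∷ v) with a ≟ᴮ b
... | no a≢b = neither (λ { (_ , refl) → a≢b refl }) (λ { (_ , refl) → a≢b refl })
... | yes refl with compare u v
...   | extends v' eq    = extends v' (cong (a ∷_) eq)
...   | extended u' eq   = extended u' (cong (a ∷_) eq)
...   | neither i j      = neither (i ∘ prefix-cancelˡ (a ∷ [])) (j ∘ prefix-cancelˡ (a ∷ []))

Commute : List Bool → List Bool → Set
Commute u v = u ++ v ≡ v ++ u

noncommuting-nonEmpty : {u v : List Bool} → ¬ Commute u v → NonEmpty u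
noncommuting-nonEmpty {v = v} nc refl = nc (sym (++-identityʳ v))

noncommuting-reduce : (u v' : List Bool) → ¬ Commute u (u ++ v') → ¬ Commute u v'
noncommuting-reduce u v' nc comm = nc (begin
  u ++ (u ++ v')   ≡⟨ cong (u ++_) comm ⟩
  u ++ (v' ++ u)   ≡⟨ ++-assoc u v' u ⟨
  (u ++ v') ++ u   ∎)
  where open ≡-Reasoning

shorter : (u v' : List Bool) → NonEmpty u → length v' < length (u ++ v')
shorter []      v' ne = ⊥-elim (ne refl)
shorter (a ∷ u) v' _  = s≤s (length-++-≤ʳ v' {u})

record Separation (f : Morphism) : Set where
  field
    prefix       : Bool → List Bool
    threshold    : ℕ
    nonEmpty     : ∀ c → NonEmpty (prefix c)
    incomparable : ∀ c → ¬ IsPrefix (prefix c) (prefix (not c))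
    begins       : ∀ c w → threshold ≤ length w → IsPrefix (prefix c) (apply f (c ∷ w))

open Separation

separation-incomparable : (f : Morphism) →
  ¬ IsPrefix (f false) (f true) → ¬ IsPrefix (f true) (f false) → Separation f
separation-incomparable f i j = record
  { prefix       = f
  ; threshold    = 0
  ; nonEmpty     = nonEmpty'
  ; incomparable = λ { false → i ; true → j }
  ; begins       = λ c w _ → apply f w , refl
  }
  where
  nonEmpty' : ∀ c → NonEmpty (f c)
  nonEmpty' false empty = i (f true , cong (_++ f true) empty)
  nonEmpty' true  empty = j (f false , cong (_++ f false) empty)

separation-cong : {f g : Morphism} → (∀ c → f c ≡ g c) → Separation f → Separation g
separation-cong {f} {g} f≗g S = record
  { prefix       = prefix S
  ; threshold    = threshold S
  ; nonEmpty     = nonEmpty S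
  ; incomparable = incomparable S
  ; begins       = λ c w K≤ →
      subst (IsPrefix (prefix S c)) (concatMap-cong f≗g (c ∷ w)) (begins S c w K≤)
  }

separation-swap : {f : Morphism} → Separation f → Separation (f ∘ not)
separation-swap {f} S = record
  { prefix       = prefix S ∘ not
  ; threshold    = threshold S
  ; nonEmpty     = nonEmpty S ∘ not
  ; incomparable = incomparable S ∘ not
  ; begins       = λ c w K≤ →
      subst (λ t → IsPrefix (prefix S (not c)) (f (not c) ++ t)) (concatMap-map f not w)
        (begins S (not c) (map not w) (subst (threshold S ≤_) (sym (length-map not w)) K≤))
  }

τ : Morphism
τ false = false ∷ []
τ true  = false ∷ true ∷ []

τ-nonErasing : ∀ c → NonEmpty (τ c)
τ-nonErasing false = λ ()
τ-nonErasing true  = λ ()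

separation-reduce : (f : Morphism) (v' : List Bool) → f false ++ v' ≡ f true →
                    Separation (morphism (f false) v') → Separation f
separation-reduce f v' eq S = record
  { prefix       = λ c → u ++ prefix S c
  ; threshold    = suc K
  ; nonEmpty     = λ c → nonEmpty-++ u (nonEmpty S c)
  ; incomparable = λ c → incomparable S c ∘ prefix-cancelˡ u
  ; begins       = λ c w K< → subst (IsPrefix (u ++ prefix S c)) (sym (factor (c ∷ w))) (begins' c w K<)
  }
  where
  u = f false
  g = morphism u v'
  K = threshold S

  factor : ∀ w → apply f w ≡ apply g (apply τ w)
  factor w = sym (trans (apply-∘ g τ w) (concatMap-cong letter w))
    where
    letter : ∀ c → apply g (τ c) ≡ f c
    letter false = ++-identityʳ u
    letter true  = trans (cong (u ++_) (++-identityʳ v')) eq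

  long : ∀ w → K ≤ length w → K ≤ length (apply τ w)
  long w K≤ = ≤-trans K≤ (length-apply τ τ-nonErasing w)

  begins' : ∀ c w → suc K ≤ length w → IsPrefix (u ++ prefix S c) (apply g (apply τ (c ∷ w)))
  begins' false (false ∷ w) (s≤s K≤) =
    prefix-++ˡ u (begins S false (apply τ w) (long w K≤))
  begins' false (true ∷ w)  (s≤s K≤) =
    prefix-++ˡ u (begins S false (true ∷ apply τ w) (≤-trans (long w K≤) (n≤1+n _)))
  begins' true  w           K<       =
    prefix-++ˡ u (begins S true (apply τ w) (long w (≤-trans (n≤1+n K) K<)))

size : Morphism → ℕ
size f = length (f false) + length (f true)

separating : (f : Morphism) → Acc _<_ (size f) → ¬ Commute (f false) (f true) → Separation f
separating f (acc smaller) nc with compare (f false) (f true)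
... | neither i j = separation-incomparable f i j
... | extends v' eq =
  separation-reduce f v' eq
    (separating (morphism u v') (smaller shrinks) (noncommuting-reduce u v' (nc ∘ subst (Commute u) eq)))
  where
  u = f false
  shrinks : length u + length v' < size f
  shrinks = subst (λ v → length u + length v' < length u + length v) eq
                  (+-monoʳ-< (length u) (shorter u v' (noncommuting-nonEmpty nc)))
... | extended u' eq =
  separation-cong (cong f ∘ not-involutive) (separation-swap (separation-reduce (f ∘ not) u' eq
    (separating (morphism v u') (smaller shrinks) (noncommuting-reduce v u' nc'))))
  where
  v = f true
  nc' : ¬ Commute v (v ++ u')
  nc' = nc ∘ sym ∘ subst (Commute v) eq
  shrinks : length v + length u' < size f
  shrinks = <-≤-trans
    (+-monoʳ-< (length v) (subst (λ u → length u' < length u) eq (shorter v u' (noncommuting-nonEmpty nc'))))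
    (≤-reflexive (+-comm (length v) (length (f false))))

separation⇒InM : {f : Morphism} → Separation f → (x : InfWord) → InM x f
separation⇒InM {f} S x =
  prefix S false , prefix S true , nonEmpty S false , nonEmpty S true ,
  (λ y _ y₀≡0 → imageBegins y y₀≡0) , (λ y _ y₀≡1 → imageBegins y y₀≡1) ,
  incomparable S false , incomparable S true
  where
  K = threshold S
  imageBegins : (y : InfWord) {c : Bool} → y 0 ≡ c → ImageBeginsWith f y (prefix S c)
  imageBegins y refl =
    suc K , begins S (y 0) (slice y 1 K) (≤-reflexive (sym (length-slice y 1 K)))

mainTheorem14 : (f : Morphism) →
    ¬ (apply f (false ∷ true ∷ []) ≡ apply f (true ∷ false ∷ [])) →
    (x : InfWord) → InM x f
mainTheorem14 f f01≢f10 = separation⇒InM (separating f (<-wellFounded (size f)) nc)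
  where
  nc : ¬ Commute (f false) (f true)
  nc comm = f01≢f10 (trans (cong (f false ++_) (++-identityʳ (f true)))
                    (trans comm (sym (cong (f true ++_) (++-identityʳ (f false))))))
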